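{- Let $\alpha=0.02$, and let $a_1=w(e_i)$, $a_2=w(e_{i+1})$, $a_3=w(e_{i+2})$, $b_1=w(o_i)$, $b_2=w(o_{i+1})$ be nonnegative reals such that $b_1\le(1+\alpha)(a_1+a_2)$, $b_2\le(1+\alpha)(a_2+a_3)$, and $g:=b_1+b_2-a_1-a_2-a_3 \ge (\tfrac12+3\alpha)a_2 + 2\alpha a_1 + 2\alpha a_3$. Then (1) $b_1\ge(1+2\alpha)(a_1+\tfrac12 a_2)$; (2) $b_2\ge(1+2\alpha)(\tfrac12 a_2 + a_3)$; (3) $g\le 3a_2$.
   Context: In the paper these quantities are the weights of consecutive edges $e_i,o_i,e_{i+1},o_{i+1},e_{i+2}$ of an alternating cycle (with $e$-edges in a current matching and $o$-edges in another matching), and $g$ is the gain of replacing $e_i,e_{i+1},e_{i+2}$ by $o_i,o_{i+1}$; the lemma is a statement purely about these numbers.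
   Formalization: The edge weights $a_1$, $a_2$, $a_3$, $b_1$, $b_2$ are nonnegative rationals rather than nonnegative reals. -}

module Defs where

open import Data.Integer using (+_)
open import Data.Rational using (ℚ; _/_; _+_; _-_; _*_)

α : ℚ
α = + 1 / 50

gain : ℚ → ℚ → ℚ → ℚ → ℚ → ℚ
gain a₁ a₂ a₃ b₁ b₂ = b₁ + b₂ - a₁ - a₂ - a₃

{-# OPTIONS --safe #-}
module Submission where

-- Each bound is a nonnegative combination of the slacks of the three hypotheses,
-- with a general ε in place of α (g₀ is the required lower bound on the gain g):
--   b₁ = (1+2ε)(a₁ + ½a₂) + (g − g₀) + ((1+ε)(a₂+a₃) − b₂) + ε(a₂+a₃),
--   (3/2 + ε)a₂ = g + 2(((1+ε)(a₁+a₂) − b₁) + ((1+ε)(a₂+a₃) − b₂)) + (g − g₀).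
-- So (1) and (2) hold for every ε ≥ 0, and g ≤ (3/2 + ε)a₂ needs no sign
-- conditions at all; for ε = α this is below 3a₂.

open import Defs
open import Data.Integer using (+_)
open import Data.Rational using (ℚ; _/_; _+_; _-_; -_; _*_; _≤_; 0ℚ; 1ℚ; ½; nonNegative)
open import Data.Rational.Properties
open import Data.Rational.Solver using (module +-*-Solver)
open import Data.Product using (_×_; _,_)
open import Relation.Binary.PropositionalEquality using (refl; subst)

open +-*-Solver
open ≤-Reasoning

p≤q⇒0≤q-p : ∀ {p q} → p ≤ q → 0ℚ ≤ q - p
p≤q⇒0≤q-p {p} {q} p≤q = subst (_≤ q - p) (+-inverseʳ p) (+-monoˡ-≤ (- p) p≤q)

p≤p+q : ∀ {p q} → 0ℚ ≤ q → p ≤ p + q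
p≤p+q {p} {q} 0≤q = subst (_≤ p + q) (+-identityʳ p) (+-monoʳ-≤ p 0≤q)

0≤p*q : ∀ {p q} → 0ℚ ≤ p → 0ℚ ≤ q → 0ℚ ≤ p * q
0≤p*q {p} {q} 0≤p 0≤q =
  subst (_≤ p * q) (*-zeroʳ p) (*-monoˡ-≤-nonNeg p {{nonNegative 0≤p}} 0≤q)

module _ {ε a₁ a₂ a₃ b₁ b₂ : ℚ} where

  private
    g g₀ : ℚ
    g  = gain a₁ a₂ a₃ b₁ b₂
    g₀ = (½ + (+ 3 / 1) * ε) * a₂ + (+ 2 / 1) * ε * a₁ + (+ 2 / 1) * ε * a₃

    gᴾ : ∀ {n} (x₁ x₂ x₃ y₁ y₂ : Polynomial n) → Polynomial n
    gᴾ x₁ x₂ x₃ y₁ y₂ = y₁ :+ y₂ :- x₁ :- x₂ :- x₃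

    g₀ᴾ : ∀ {n} (e x₁ x₂ x₃ : Polynomial n) → Polynomial n
    g₀ᴾ e x₁ x₂ x₃ =
      (con ½ :+ con (+ 3 / 1) :* e) :* x₂ :+ con (+ 2 / 1) :* e :* x₁ :+ con (+ 2 / 1) :* e :* x₃

  b₁-lowerBound : 0ℚ ≤ ε → 0ℚ ≤ a₂ → 0ℚ ≤ a₃ →
    b₂ ≤ (1ℚ + ε) * (a₂ + a₃) → g₀ ≤ g →
    (1ℚ + (+ 2 / 1) * ε) * (a₁ + ½ * a₂) ≤ b₁
  b₁-lowerBound 0≤ε 0≤a₂ 0≤a₃ b₂≤ g₀≤g = begin
    (1ℚ + (+ 2 / 1) * ε) * (a₁ + ½ * a₂)
      ≤⟨ p≤p+q (+-mono-≤ (+-mono-≤ (p≤q⇒0≤q-p g₀≤g) (p≤q⇒0≤q-p b₂≤))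
                         (0≤p*q 0≤ε (+-mono-≤ 0≤a₂ 0≤a₃))) ⟩
    (1ℚ + (+ 2 / 1) * ε) * (a₁ + ½ * a₂)
      + ((g - g₀) + ((1ℚ + ε) * (a₂ + a₃) - b₂) + ε * (a₂ + a₃))
      ≡⟨ solve 6 (λ e x₁ x₂ x₃ y₁ y₂ →
           (con 1ℚ :+ con (+ 2 / 1) :* e) :* (x₁ :+ con ½ :* x₂)
             :+ ((gᴾ x₁ x₂ x₃ y₁ y₂ :- g₀ᴾ e x₁ x₂ x₃)
                 :+ ((con 1ℚ :+ e) :* (x₂ :+ x₃) :- y₂) :+ e :* (x₂ :+ x₃))
           := y₁)
         refl ε a₁ a₂ a₃ b₁ b₂ ⟩
    b₁ ∎

  b₂-lowerBound : 0ℚ ≤ ε → 0ℚ ≤ a₁ → 0ℚ ≤ a₂ →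
    b₁ ≤ (1ℚ + ε) * (a₁ + a₂) → g₀ ≤ g →
    (1ℚ + (+ 2 / 1) * ε) * (½ * a₂ + a₃) ≤ b₂
  b₂-lowerBound 0≤ε 0≤a₁ 0≤a₂ b₁≤ g₀≤g = begin
    (1ℚ + (+ 2 / 1) * ε) * (½ * a₂ + a₃)
      ≤⟨ p≤p+q (+-mono-≤ (+-mono-≤ (p≤q⇒0≤q-p g₀≤g) (p≤q⇒0≤q-p b₁≤))
                         (0≤p*q 0≤ε (+-mono-≤ 0≤a₁ 0≤a₂))) ⟩
    (1ℚ + (+ 2 / 1) * ε) * (½ * a₂ + a₃)
      + ((g - g₀) + ((1ℚ + ε) * (a₁ + a₂) - b₁) + ε * (a₁ + a₂))
      ≡⟨ solve 6 (λ e x₁ x₂ x₃ y₁ y₂ →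
           (con 1ℚ :+ con (+ 2 / 1) :* e) :* (con ½ :* x₂ :+ x₃)
             :+ ((gᴾ x₁ x₂ x₃ y₁ y₂ :- g₀ᴾ e x₁ x₂ x₃)
                 :+ ((con 1ℚ :+ e) :* (x₁ :+ x₂) :- y₁) :+ e :* (x₁ :+ x₂))
           := y₂)
         refl ε a₁ a₂ a₃ b₁ b₂ ⟩
    b₂ ∎

  gain-upperBound : b₁ ≤ (1ℚ + ε) * (a₁ + a₂) → b₂ ≤ (1ℚ + ε) * (a₂ + a₃) → g₀ ≤ g →
    g ≤ (+ 3 / 2 + ε) * a₂
  gain-upperBound b₁≤ b₂≤ g₀≤g = begin
    g
      ≤⟨ p≤p+q (+-mono-≤ (0≤p*q (nonNegative⁻¹ (+ 2 / 1))
                                (+-mono-≤ (p≤q⇒0≤q-p b₁≤) (p≤q⇒0≤q-p b₂≤)))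
                         (p≤q⇒0≤q-p g₀≤g)) ⟩
    g + ((+ 2 / 1) * (((1ℚ + ε) * (a₁ + a₂) - b₁) + ((1ℚ + ε) * (a₂ + a₃) - b₂)) + (g - g₀))
      ≡⟨ solve 6 (λ e x₁ x₂ x₃ y₁ y₂ →
           gᴾ x₁ x₂ x₃ y₁ y₂
             :+ (con (+ 2 / 1) :* (((con 1ℚ :+ e) :* (x₁ :+ x₂) :- y₁)
                                   :+ ((con 1ℚ :+ e) :* (x₂ :+ x₃) :- y₂))
                 :+ (gᴾ x₁ x₂ x₃ y₁ y₂ :- g₀ᴾ e x₁ x₂ x₃))
           := (con (+ 3 / 2) :+ e) :* x₂)
         refl ε a₁ a₂ a₃ b₁ b₂ ⟩
    (+ 3 / 2 + ε) * a₂ ∎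

lemma5 : (a₁ a₂ a₃ b₁ b₂ : ℚ) →
    0ℚ ≤ a₁ → 0ℚ ≤ a₂ → 0ℚ ≤ a₃ → 0ℚ ≤ b₁ → 0ℚ ≤ b₂ →
    b₁ ≤ (1ℚ + α) * (a₁ + a₂) →
    b₂ ≤ (1ℚ + α) * (a₂ + a₃) →
    (½ + (+ 3 / 1) * α) * a₂ + (+ 2 / 1) * α * a₁ + (+ 2 / 1) * α * a₃ ≤ gain a₁ a₂ a₃ b₁ b₂ →
    ((1ℚ + (+ 2 / 1) * α) * (a₁ + ½ * a₂) ≤ b₁)
    × ((1ℚ + (+ 2 / 1) * α) * (½ * a₂ + a₃) ≤ b₂)
    × (gain a₁ a₂ a₃ b₁ b₂ ≤ (+ 3 / 1) * a₂)
lemma5 a₁ a₂ a₃ b₁ b₂ 0≤a₁ 0≤a₂ 0≤a₃ _ _ b₁≤ b₂≤ g₀≤g =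
    b₁-lowerBound 0≤α 0≤a₂ 0≤a₃ b₂≤ g₀≤g
  , b₂-lowerBound 0≤α 0≤a₁ 0≤a₂ b₁≤ g₀≤g
  , (begin
      gain a₁ a₂ a₃ b₁ b₂  ≤⟨ gain-upperBound {α} b₁≤ b₂≤ g₀≤g ⟩
      (+ 3 / 2 + α) * a₂   ≤⟨ *-monoʳ-≤-nonNeg a₂ {{nonNegative 0≤a₂}} 3/2+α≤3 ⟩
      (+ 3 / 1) * a₂       ∎)
  where
  0≤α : 0ℚ ≤ α
  0≤α = nonNegative⁻¹ α

  3/2+α≤3 : + 3 / 2 + α ≤ + 3 / 1
  3/2+α≤3 = ≤ᵇ⇒≤ _
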